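{- Let $(\mathbb{X},\dagger)$ be a dagger idempotent complete category. Then a map $f: A \to B$ in $\mathbb{X}$ is Moore-Penrose invertible if and only if $f$ has a generalized compact singular value decomposition.
   Context: Composition is written in diagrammatic order: for $f: A\to B$, $g: B \to C$, $fg: A \to C$. A dagger category $(\mathbb{X},\dagger)$ is a category with an identity-on-objects contravariant involutive functor $\dagger$, so each $f: A\to B$ has $f^\dagger: B \to A$ with $1_A^\dagger = 1_A$, $(fg)^\dagger = g^\dagger f^\dagger$, $f^{\dagger\dagger}=f$. A map $s: A\to B$ is an isometry if $ss^\dagger = 1_A$; a map $r: A \to B$ is a coisometry if $r^\dagger r = 1_B$. A Moore-Penrose inverse of $f: A \to B$ is a map $f^\circ: B \to A$ with $ff^\circ f = f$, $f^\circ f f^\circ = f^\circ$, $(ff^\circ)^\dagger = ff^\circ$, $(f^\circ f)^\dagger = f^\circ f$; $f$ is Moore-Penrose invertible if it has one. A $\dagger$-idempotent is $e: A\to A$ with $ee = e = e^\dagger$; it $\dagger$-splits if there is $r: A \to X$ with $rr^\dagger = e$ and $r^\dagger r = 1_X$. A dagger category is dagger idempotent complete if every $\dagger$-idempotent $\dagger$-splits. A generalized compact singular value decomposition (GCSVD) of $f: A \to B$ is a triple $(r: A \to X, d: X \to Y, s: Y \to B)$ with $r$ a coisometry, $d$ an isomorphism, $s$ an isometry, and $f = rds$. -}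

module Defs where

open import Level using (Level; _⊔_; suc)
open import Relation.Binary using (IsEquivalence)
open import Data.Product using (Σ; _×_; ∃-syntax)

-- A category with hom-setoids, composition in diagrammatic order (f ⨾ g : A → C
-- for f : A → B, g : B → C).
record Category (o ℓ e : Level) : Set (suc (o ⊔ ℓ ⊔ e)) where
  infixr 9 _⨾_
  infix 4 _≈_
  field
    Obj   : Set o
    Hom   : Obj → Obj → Set ℓ
    _≈_   : ∀ {A B} → Hom A B → Hom A B → Set e
    id    : ∀ {A} → Hom A A
    _⨾_   : ∀ {A B C} → Hom A B → Hom B C → Hom A C
    ≈-equiv : ∀ {A B} → IsEquivalence (_≈_ {A} {B})
    ⨾-resp-≈ : ∀ {A B C} {f f' : Hom A B} {g g' : Hom B C} →
               f ≈ f' → g ≈ g' → f ⨾ g ≈ f' ⨾ g'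
    identityˡ : ∀ {A B} {f : Hom A B} → id ⨾ f ≈ f
    identityʳ : ∀ {A B} {f : Hom A B} → f ⨾ id ≈ f
    assoc : ∀ {A B C D} {f : Hom A B} {g : Hom B C} {h : Hom C D} →
            (f ⨾ g) ⨾ h ≈ f ⨾ (g ⨾ h)

record DaggerCategory (o ℓ e : Level) : Set (suc (o ⊔ ℓ ⊔ e)) where
  field
    category : Category o ℓ e
  open Category category public
  field
    _† : ∀ {A B} → Hom A B → Hom B A
    †-resp-≈ : ∀ {A B} {f g : Hom A B} → f ≈ g → f † ≈ g †
    †-identity : ∀ {A} → (id {A}) † ≈ id
    †-homomorphism : ∀ {A B C} {f : Hom A B} {g : Hom B C} →
                     (f ⨾ g) † ≈ (g †) ⨾ (f †)
    †-involutive : ∀ {A B} {f : Hom A B} → (f †) † ≈ f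

module _ {o ℓ e} (𝕏 : DaggerCategory o ℓ e) where
  open DaggerCategory 𝕏

  IsIsometry : ∀ {A B} → Hom A B → Set e
  IsIsometry s = s ⨾ (s †) ≈ id

  IsCoisometry : ∀ {A B} → Hom A B → Set e
  IsCoisometry r = (r †) ⨾ r ≈ id

  IsIso : ∀ {A B} → Hom A B → Set (ℓ ⊔ e)
  IsIso {A} {B} d = Σ (Hom B A) λ d⁻¹ → (d ⨾ d⁻¹ ≈ id) × (d⁻¹ ⨾ d ≈ id)

  IsMoorePenroseInverse : ∀ {A B} → Hom A B → Hom B A → Set e
  IsMoorePenroseInverse f f° =
    (f ⨾ f° ⨾ f ≈ f) × (f° ⨾ f ⨾ f° ≈ f°) ×
    (((f ⨾ f°) †) ≈ f ⨾ f°) × (((f° ⨾ f) †) ≈ f° ⨾ f)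

  MoorePenroseInvertible : ∀ {A B} → Hom A B → Set (ℓ ⊔ e)
  MoorePenroseInvertible {A} {B} f = Σ (Hom B A) λ f° → IsMoorePenroseInverse f f°

  IsDaggerIdempotent : ∀ {A} → Hom A A → Set e
  IsDaggerIdempotent e' = (e' ⨾ e' ≈ e') × (e' † ≈ e')

  DaggerSplits : ∀ {A} → Hom A A → Set (o ⊔ ℓ ⊔ e)
  DaggerSplits {A} e' = ∃[ X ] Σ (Hom A X) λ r → (r ⨾ (r †) ≈ e') × ((r †) ⨾ r ≈ id)

  DaggerIdempotentComplete : Set (o ⊔ ℓ ⊔ e)
  DaggerIdempotentComplete = ∀ {A} (e' : Hom A A) → IsDaggerIdempotent e' → DaggerSplits e'

  HasGCSVD : ∀ {A B} → Hom A B → Set (o ⊔ ℓ ⊔ e)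
  HasGCSVD {A} {B} f =
    ∃[ X ] ∃[ Y ] Σ (Hom A X) λ r → Σ (Hom X Y) λ d → Σ (Hom Y B) λ s →
      IsCoisometry r × IsIso d × IsIsometry s × (f ≈ r ⨾ d ⨾ s)

{-# OPTIONS --safe #-}
-- If f° is a Moore-Penrose inverse of f, then f ⨾ f° and f° ⨾ f are †-idempotents;
-- †-splitting them as r ⨾ r † and t ⨾ t † gives f = r ⨾ (r † ⨾ f ⨾ t) ⨾ t †, where the
-- middle factor has inverse t † ⨾ f° ⨾ r. Conversely, from f = r ⨾ d ⨾ s the map
-- s † ⨾ d⁻¹ ⨾ r † is a Moore-Penrose inverse, since it makes f ⨾ f° = r ⨾ r † and
-- f° ⨾ f = s † ⨾ s, both self-adjoint.
module Submission where

open import Defs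
open import Level using (Level)
open import Function.Bundles using (_⇔_; mk⇔)
open import Data.Product using (_,_)
open import Relation.Binary using (IsEquivalence; Setoid)
import Relation.Binary.Reasoning.Setoid as SetoidReasoning

module CategoryReasoning {o ℓ e : Level} (𝒞 : Category o ℓ e) where
  open Category 𝒞

  hom-setoid : Obj → Obj → Setoid ℓ e
  hom-setoid A B = record { Carrier = Hom A B ; _≈_ = _≈_ ; isEquivalence = ≈-equiv }

  module _ {A B : Obj} where
    open IsEquivalence (≈-equiv {A} {B}) public
      using () renaming (refl to ≈-refl; sym to ≈-sym; trans to ≈-trans)
    open SetoidReasoning (hom-setoid A B) public

  infixr 4 refl⟩⨾⟨_
  infixl 5 _⟩⨾⟨refl

  refl⟩⨾⟨_ : ∀ {A B C} {f : Hom A B} {g g′ : Hom B C} → g ≈ g′ → f ⨾ g ≈ f ⨾ g′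
  refl⟩⨾⟨ p = ⨾-resp-≈ ≈-refl p

  _⟩⨾⟨refl : ∀ {A B C} {f f′ : Hom A B} {g : Hom B C} → f ≈ f′ → f ⨾ g ≈ f′ ⨾ g
  p ⟩⨾⟨refl = ⨾-resp-≈ p ≈-refl

  assoc² : ∀ {A B C D E} {a : Hom A B} {b : Hom B C} {c : Hom C D} {w : Hom D E} →
           (a ⨾ b ⨾ c) ⨾ w ≈ a ⨾ b ⨾ c ⨾ w
  assoc² = ≈-trans assoc (refl⟩⨾⟨ assoc)

  pullˡ : ∀ {A B C D} {x : Hom A B} {y : Hom B C} {z : Hom A C} {w : Hom C D} →
          x ⨾ y ≈ z → x ⨾ y ⨾ w ≈ z ⨾ w
  pullˡ p = ≈-trans (≈-sym assoc) (p ⟩⨾⟨refl)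

  cancelˡ : ∀ {A B C} {x : Hom A B} {y : Hom B A} {w : Hom A C} →
            x ⨾ y ≈ id → x ⨾ y ⨾ w ≈ w
  cancelˡ p = ≈-trans (pullˡ p) identityˡ

  cancel-middle : ∀ {A B C D} {a : Hom A B} {b : Hom B C} {c : Hom C D}
                  {c′ : Hom D C} {b′ : Hom C B} {a′ : Hom B A} →
                  c ⨾ c′ ≈ id → b ⨾ b′ ≈ id → (a ⨾ b ⨾ c) ⨾ c′ ⨾ b′ ⨾ a′ ≈ a ⨾ a′
  cancel-middle {a = a} {b} {c} {c′} {b′} {a′} cc′≈id bb′≈id = begin
    (a ⨾ b ⨾ c) ⨾ c′ ⨾ b′ ⨾ a′  ≈⟨ assoc² ⟩
    a ⨾ b ⨾ c ⨾ c′ ⨾ b′ ⨾ a′    ≈⟨ refl⟩⨾⟨ refl⟩⨾⟨ cancelˡ cc′≈id ⟩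
    a ⨾ b ⨾ b′ ⨾ a′             ≈⟨ refl⟩⨾⟨ cancelˡ bb′≈id ⟩
    a ⨾ a′                      ∎

  cancel-right : ∀ {A B C D} {a : Hom A B} {b : Hom B C} {c : Hom C D} {c′ : Hom D C} →
                 c ⨾ c′ ≈ id → (a ⨾ b ⨾ c) ⨾ c′ ⨾ c ≈ a ⨾ b ⨾ c
  cancel-right {a = a} {b} {c} {c′} cc′≈id = begin
    (a ⨾ b ⨾ c) ⨾ c′ ⨾ c  ≈⟨ assoc² ⟩
    a ⨾ b ⨾ c ⨾ c′ ⨾ c    ≈⟨ refl⟩⨾⟨ refl⟩⨾⟨ cancelˡ cc′≈id ⟩
    a ⨾ b ⨾ c             ∎

module DaggerLemmas {o ℓ e : Level} (𝕏 : DaggerCategory o ℓ e) where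
  open DaggerCategory 𝕏
  open CategoryReasoning category

  ⨾†-selfAdjoint : ∀ {A B} (x : Hom A B) → (x ⨾ x †) † ≈ x ⨾ x †
  ⨾†-selfAdjoint x = ≈-trans †-homomorphism (†-involutive ⟩⨾⟨refl)

  †⨾-selfAdjoint : ∀ {A B} (x : Hom A B) → (x † ⨾ x) † ≈ x † ⨾ x
  †⨾-selfAdjoint x = ≈-trans †-homomorphism (refl⟩⨾⟨ †-involutive)

  selfAdjoint-resp-≈ : ∀ {A} {h k : Hom A A} → h ≈ k → k † ≈ k → h † ≈ h
  selfAdjoint-resp-≈ h≈k k†≈k = ≈-trans (†-resp-≈ h≈k) (≈-trans k†≈k (≈-sym h≈k))

  coisometry⇒†-isometry : ∀ {A B} {t : Hom A B} → IsCoisometry 𝕏 t → IsIsometry 𝕏 (t †)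
  coisometry⇒†-isometry t†t≈id = ≈-trans (refl⟩⨾⟨ †-involutive) t†t≈id

  splitting-absorbˡ : ∀ {A X} {r : Hom A X} {p : Hom A A} →
                      r ⨾ r † ≈ p → r † ⨾ r ≈ id → p ⨾ r ≈ r
  splitting-absorbˡ {r = r} {p} rr†≈p r†r≈id = begin
    p ⨾ r          ≈⟨ rr†≈p ⟩⨾⟨refl ⟨
    (r ⨾ r †) ⨾ r  ≈⟨ assoc ⟩
    r ⨾ r † ⨾ r    ≈⟨ refl⟩⨾⟨ r†r≈id ⟩
    r ⨾ id         ≈⟨ identityʳ ⟩
    r              ∎

module MoorePenrose {o ℓ e : Level} (𝕏 : DaggerCategory o ℓ e) where
  open DaggerCategory 𝕏
  open CategoryReasoning category
  open DaggerLemmas 𝕏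

  module _ {A B} {f : Hom A B} {g : Hom B A} where

    isMoorePenroseInverse-sym : IsMoorePenroseInverse 𝕏 f g → IsMoorePenroseInverse 𝕏 g f
    isMoorePenroseInverse-sym (fgf≈f , gfg≈g , fg-sa , gf-sa) = gfg≈g , fgf≈f , gf-sa , fg-sa

    isMoorePenroseInverse⇒⨾-isDaggerIdempotent :
      IsMoorePenroseInverse 𝕏 f g → IsDaggerIdempotent 𝕏 (f ⨾ g)
    isMoorePenroseInverse⇒⨾-isDaggerIdempotent (_ , gfg≈g , fg-sa , _) =
      ≈-trans assoc (refl⟩⨾⟨ gfg≈g) , fg-sa

  module _ {A B X Y} {f : Hom A B} {g : Hom B A} {r : Hom A X} {t : Hom B Y}
           (fgf≈f : f ⨾ g ⨾ f ≈ f) (rr†≈fg : r ⨾ r † ≈ f ⨾ g) (tt†≈gf : t ⨾ t † ≈ g ⨾ f) where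

    splitting-core-inverse : r † ⨾ r ≈ id → (r † ⨾ f ⨾ t) ⨾ (t † ⨾ g ⨾ r) ≈ id
    splitting-core-inverse r†r≈id = begin
      (r † ⨾ f ⨾ t) ⨾ t † ⨾ g ⨾ r  ≈⟨ assoc² ⟩
      r † ⨾ f ⨾ t ⨾ t † ⨾ g ⨾ r    ≈⟨ refl⟩⨾⟨ refl⟩⨾⟨ pullˡ tt†≈gf ⟩
      r † ⨾ f ⨾ (g ⨾ f) ⨾ g ⨾ r    ≈⟨ refl⟩⨾⟨ pullˡ fgf≈f ⟩
      r † ⨾ f ⨾ g ⨾ r              ≈⟨ refl⟩⨾⟨ assoc ⟨
      r † ⨾ (f ⨾ g) ⨾ r            ≈⟨ refl⟩⨾⟨ splitting-absorbˡ rr†≈fg r†r≈id ⟩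
      r † ⨾ r                      ≈⟨ r†r≈id ⟩
      id                           ∎

    splitting-factorisation : f ≈ r ⨾ (r † ⨾ f ⨾ t) ⨾ t †
    splitting-factorisation = begin
      f                        ≈⟨ fgf≈f ⟨
      f ⨾ g ⨾ f                ≈⟨ refl⟩⨾⟨ tt†≈gf ⟨
      f ⨾ t ⨾ t †              ≈⟨ pullˡ fgf≈f ⟨
      f ⨾ (g ⨾ f) ⨾ t ⨾ t †    ≈⟨ refl⟩⨾⟨ assoc ⟩
      f ⨾ g ⨾ f ⨾ t ⨾ t †      ≈⟨ assoc ⟨
      (f ⨾ g) ⨾ f ⨾ t ⨾ t †    ≈⟨ pullˡ rr†≈fg ⟨
      r ⨾ r † ⨾ f ⨾ t ⨾ t †    ≈⟨ refl⟩⨾⟨ assoc² ⟨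
      r ⨾ (r † ⨾ f ⨾ t) ⨾ t †  ∎

  module _ {A B} {f : Hom A B} where

    splittings⇒GCSVD : ∀ {g : Hom B A} → IsMoorePenroseInverse 𝕏 f g →
                       DaggerSplits 𝕏 (f ⨾ g) → DaggerSplits 𝕏 (g ⨾ f) → HasGCSVD 𝕏 f
    splittings⇒GCSVD {g} (fgf≈f , gfg≈g , _ , _) (X , r , rr†≈fg , r†r≈id) (Y , t , tt†≈gf , t†t≈id) =
      X , Y , r , r † ⨾ f ⨾ t , t † ,
      r†r≈id ,
      (t † ⨾ g ⨾ r , splitting-core-inverse fgf≈f rr†≈fg tt†≈gf r†r≈id
                   , splitting-core-inverse gfg≈g tt†≈gf rr†≈fg t†t≈id) ,
      coisometry⇒†-isometry t†t≈id ,
      splitting-factorisation fgf≈f rr†≈fg tt†≈gf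

    GCSVD⇒MoorePenroseInvertible : HasGCSVD 𝕏 f → MoorePenroseInvertible 𝕏 f
    GCSVD⇒MoorePenroseInvertible
      (X , Y , r , d , s , r†r≈id , (d⁻¹ , dd⁻¹≈id , d⁻¹d≈id) , ss†≈id , f≈rds) =
      f° , fgf≈f , gfg≈g , selfAdjoint-resp-≈ ff°≈rr† (⨾†-selfAdjoint r)
                         , selfAdjoint-resp-≈ f°f≈s†s (†⨾-selfAdjoint s)
      where
      f° : Hom B A
      f° = s † ⨾ d⁻¹ ⨾ r †

      ff°≈rr† : f ⨾ f° ≈ r ⨾ r †
      ff°≈rr† = ≈-trans (f≈rds ⟩⨾⟨refl) (cancel-middle ss†≈id dd⁻¹≈id)

      f°f≈s†s : f° ⨾ f ≈ s † ⨾ s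
      f°f≈s†s = ≈-trans (refl⟩⨾⟨ f≈rds) (cancel-middle r†r≈id d⁻¹d≈id)

      fgf≈f : f ⨾ f° ⨾ f ≈ f
      fgf≈f = begin
        f ⨾ f° ⨾ f            ≈⟨ refl⟩⨾⟨ f°f≈s†s ⟩
        f ⨾ s † ⨾ s           ≈⟨ f≈rds ⟩⨾⟨refl ⟩
        (r ⨾ d ⨾ s) ⨾ s † ⨾ s ≈⟨ cancel-right ss†≈id ⟩
        r ⨾ d ⨾ s             ≈⟨ f≈rds ⟨
        f                     ∎

      gfg≈g : f° ⨾ f ⨾ f° ≈ f°
      gfg≈g = ≈-trans (refl⟩⨾⟨ ff°≈rr†) (cancel-right r†r≈id)

mainTheorem1 : ∀ {o ℓ e : Level} (𝕏 : DaggerCategory o ℓ e) →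
    DaggerIdempotentComplete 𝕏 →
    ∀ {A B : DaggerCategory.Obj 𝕏} (f : DaggerCategory.Hom 𝕏 A B) →
    MoorePenroseInvertible 𝕏 f ⇔ HasGCSVD 𝕏 f
mainTheorem1 𝕏 complete f = mk⇔ decompose GCSVD⇒MoorePenroseInvertible
  where
  open DaggerCategory 𝕏
  open MoorePenrose 𝕏

  decompose : MoorePenroseInvertible 𝕏 f → HasGCSVD 𝕏 f
  decompose (f° , mp) = splittings⇒GCSVD mp
    (complete (f ⨾ f°) (isMoorePenroseInverse⇒⨾-isDaggerIdempotent mp))
    (complete (f° ⨾ f) (isMoorePenroseInverse⇒⨾-isDaggerIdempotent (isMoorePenroseInverse-sym mp)))
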